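{- Let $G_T=(V_T,E_T)$, $G_W=(V_W,E_W)$ be graphs, let $N\subseteq V_T$ be a node cover of $G_T$, and let $M$ be a partial match on $N$. Suppose that for every $u\in V_T\setminus N$ the candidate set $C[u]$ is exactly the set of $c\in V_W$ such that $(u,c)$ is joinable to $M$. Let $w_1,w_2\in V_W$ be world vertices not in the image of $M$ with $w_1\sim_{N,M}w_2$. Then $w_1$ and $w_2$ are $M$-interchangeable.
   Context: A graph is a pair $G=(V,E)$ with $V$ finite and $E\subseteq V\times V$ (directed edges), with no self-loops. A subgraph isomorphism from $G_T$ to $G_W$ is an injective $f:V_T\to V_W$ with $(t_1,t_2)\in E_T\Rightarrow(f(t_1),f(t_2))\in E_W$. A node cover of $G_T$ is a set $N\subseteq V_T$ such that every edge of $E_T$ has at least one endpoint in $N$. A partial match on $N$ is a subgraph isomorphism from the subgraph of $G_T$ induced on $N$ to $G_W$, written as a set of pairs $M=\{(v_1,w_1),\dots,(v_k,w_k)\}$ with $N=\{v_1,\dots,v_k\}$. A pair $(v,c)\in V_T\times V_W$ is joinable to $M$ if for each $(v_i,w_i)\in M$: $(v_i,v)\in E_T\Rightarrow(w_i,c)\in E_W$ and $(v,v_i)\in E_T\Rightarrow(c,w_i)\in E_W$. Two world vertices $w_1,w_2$ are node cover equivalent with respect to $M$, $w_1\sim_{N,M}w_2$, if for all $u\in V_T\setminus N$: $w_1\in C[u]\Leftrightarrow w_2\in C[u]$. World vertices $w_1,w_2$ are $M$-interchangeable if for every subgraph isomorphism $f:V_T\to V_W$ extending $M$ (i.e. $f(v_i)=w_i$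 for all $(v_i,w_i)\in M$): if both lie in the image of $f$, say $f(v)=w_1$, $f(w)=w_2$, then the map obtained from $f$ by setting $v\mapsto w_2$, $w\mapsto w_1$ is a subgraph isomorphism; and if only one lies in the image, say $f(v)=w_1$ (resp. $f(v)=w_2$), then the map obtained from $f$ by setting $v\mapsto w_2$ (resp. $v\mapsto w_1$) is a subgraph isomorphism. -}

module Defs where

open import Data.Nat using (ℕ)
open import Data.Fin using (Fin; _≟_)
open import Data.Product using (Σ; _×_; _,_)
open import Data.Sum using (_⊎_)
open import Data.Bool using (if_then_else_)
open import Relation.Nullary using (¬_; does)
open import Relation.Binary.PropositionalEquality using (_≡_; _≢_)
open import Function.Bundles using (_⇔_)

record Graph (n : ℕ) : Set₁ where
  field
    E      : Fin n → Fin n → Set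
    noLoop : ∀ v → ¬ E v v
open Graph public

Pred : ℕ → Set₁
Pred n = Fin n → Set

IsNodeCover : ∀ {n} → Graph n → Pred n → Set
IsNodeCover G N = ∀ a b → E G a b → N a ⊎ N b

IsSubIso : ∀ {nT nW} → Graph nT → Graph nW → (Fin nT → Fin nW) → Set
IsSubIso GT GW f =
  (∀ x y → f x ≡ f y → x ≡ y) × (∀ a b → E GT a b → E GW (f a) (f b))

PartialMap : ∀ {nT} → Pred nT → ℕ → Set
PartialMap {nT} N nW = (v : Fin nT) → N v → Fin nW

IsPartialMatch : ∀ {nT nW} → Graph nT → Graph nW → (N : Pred nT) → PartialMap N nW → Set
IsPartialMatch GT GW N m =
  (∀ x y (px : N x) (py : N y) → m x px ≡ m y py → x ≡ y)
  × (∀ a b (pa : N a) (pb : N b) → E GT a b → E GW (m a pa) (m b pb))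

InImage : ∀ {nT nW} {N : Pred nT} → PartialMap N nW → Fin nW → Set
InImage {N = N} m w = Σ _ λ v → Σ (N v) λ p → m v p ≡ w

Joinable : ∀ {nT nW} → Graph nT → Graph nW → (N : Pred nT) → PartialMap N nW
         → Fin nT → Fin nW → Set
Joinable GT GW N m v c =
  ∀ vi (p : N vi) → (E GT vi v → E GW (m vi p) c) × (E GT v vi → E GW c (m vi p))

Extends : ∀ {nT nW} {N : Pred nT} → PartialMap N nW → (Fin nT → Fin nW) → Set
Extends {N = N} m f = ∀ v (p : N v) → f v ≡ m v p

NCEquiv : ∀ {nT nW} → (N : Pred nT) → (C : Fin nT → Pred nW) → Fin nW → Fin nW → Set
NCEquiv N C w1 w2 = ∀ u → ¬ N u → (C u w1 ⇔ C u w2)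

_[_↦_] : ∀ {nT nW} → (Fin nT → Fin nW) → Fin nT → Fin nW → (Fin nT → Fin nW)
(f [ v ↦ c ]) x = if does (x ≟ v) then c else f x

Interchangeable : ∀ {nT nW} → Graph nT → Graph nW → (N : Pred nT) → PartialMap N nW
                → Fin nW → Fin nW → Set
Interchangeable GT GW N m w1 w2 =
  ∀ (f : Fin _ → Fin _) → IsSubIso GT GW f → Extends m f →
    ((∀ v w → f v ≡ w1 → f w ≡ w2 → IsSubIso GT GW ((f [ v ↦ w2 ]) [ w ↦ w1 ]))
    × (∀ v → f v ≡ w1 → (∀ x → f x ≢ w2) → IsSubIso GT GW (f [ v ↦ w2 ]))
    × (∀ v → f v ≡ w2 → (∀ x → f x ≢ w1) → IsSubIso GT GW (f [ v ↦ w1 ])))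

{-# OPTIONS --safe #-}
module Submission where

-- Let τ be the transposition of w1 and w2.  Each of the three modified maps
-- in the definition of interchangeability is τ ∘ f, so it suffices that
-- τ ∘ f is a subgraph isomorphism whenever f is one extending M.  For an edge (a , b) the node cover puts, say, a in N;
-- then f a = M a is fixed by τ, while b has a joinable image under τ ∘ f: if
-- f b ∈ {w1 , w2} then b ∉ N, and node cover equivalence moves the candidate
-- f b to τ (f b), which is therefore joinable as well.

open import Defs
open import Data.Nat using (ℕ)
open import Data.Fin using (Fin; _≟_)
open import Data.Fin.Permutation.Components using (transpose; transpose-inverse)
open import Data.Product using (_,_; proj₁; proj₂)
open import Data.Sum using (inj₁; inj₂)
open import Function using (_∘_)
open import Function.Bundles using (_⇔_; Equivalence)
open import Function.Properties.Equivalence using () renaming (sym to ⇔-sym; trans to ⇔-trans)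
open import Function.Definitions using (Injective)
open import Relation.Nullary using (¬_; yes; no; contradiction)
open import Relation.Binary.PropositionalEquality

module _ {n : ℕ} where

  transpose-injective : (i j : Fin n) → Injective _≡_ _≡_ (transpose i j)
  transpose-injective i j {k} {l} eq = begin
    k                                ≡⟨ sym (transpose-inverse j i) ⟩
    transpose j i (transpose i j k)  ≡⟨ cong (transpose j i) eq ⟩
    transpose j i (transpose i j l)  ≡⟨ transpose-inverse j i ⟩
    l                                ∎
    where open ≡-Reasoning

  transpose-mapsˡ : (i j : Fin n) → transpose i j i ≡ j
  transpose-mapsˡ i j with i ≟ i
  ... | yes _   = refl
  ... | no  i≢i = contradiction refl i≢i

  transpose-mapsʳ : (i j : Fin n) → transpose i j j ≡ i
  transpose-mapsʳ i j with j ≟ i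
  ... | yes j≡i = j≡i
  ... | no  _ with j ≟ j
  ...   | yes _   = refl
  ...   | no  j≢j = contradiction refl j≢j

  transpose-fixes : (i j : Fin n) {k : Fin n} → k ≢ i → k ≢ j → transpose i j k ≡ k
  transpose-fixes i j {k} k≢i k≢j with k ≟ i
  ... | yes k≡i = contradiction k≡i k≢i
  ... | no  _ with k ≟ j
  ...   | yes k≡j = contradiction k≡j k≢j
  ...   | no  _   = refl

  transpose-preserves : (P : Fin n → Set) {i j k : Fin n} →
                        (k ≡ i → P j) → (k ≡ j → P i) → P k → P (transpose i j k)
  transpose-preserves P {i} {j} {k} k≡i⇒Pj k≡j⇒Pi Pk with k ≟ i
  ... | yes k≡i = k≡i⇒Pj k≡i
  ... | no  _ with k ≟ j
  ...   | yes k≡j = k≡j⇒Pi k≡j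
  ...   | no  _   = Pk

module _ {nT nW : ℕ} {f : Fin nT → Fin nW} (f-inj : Injective _≡_ _≡_ f) {i j : Fin nW} where

  injective-≢ : ∀ {v x} {k : Fin nW} → f v ≡ k → x ≢ v → f x ≢ k
  injective-≢ fv≡k x≢v fx≡k = x≢v (f-inj (trans fx≡k (sym fv≡k)))

  update-≗-transpose : ∀ {v} → f v ≡ i → (∀ x → f x ≢ j) →
                       ∀ x → (f [ v ↦ j ]) x ≡ transpose i j (f x)
  update-≗-transpose {v} fv≡i j∉f x with x ≟ v
  ... | yes refl = trans (sym (transpose-mapsˡ i j)) (cong (transpose i j) (sym fv≡i))
  ... | no  x≢v  = sym (transpose-fixes i j (injective-≢ fv≡i x≢v) (j∉f x))

  update²-≗-transpose : ∀ {v w} → f v ≡ i → f w ≡ j →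
                        ∀ x → ((f [ v ↦ j ]) [ w ↦ i ]) x ≡ transpose i j (f x)
  update²-≗-transpose {v} {w} fv≡i fw≡j x with x ≟ w
  ... | yes refl = trans (sym (transpose-mapsʳ i j)) (cong (transpose i j) (sym fw≡j))
  ... | no  x≢w with x ≟ v
  ...   | yes refl = trans (sym (transpose-mapsˡ i j)) (cong (transpose i j) (sym fv≡i))
  ...   | no  x≢v  = sym (transpose-fixes i j (injective-≢ fv≡i x≢v) (injective-≢ fw≡j x≢w))

module _ {nT nW : ℕ} (GT : Graph nT) (GW : Graph nW) where

  IsSubIso-resp-≗ : {f g : Fin nT → Fin nW} → (∀ x → g x ≡ f x) →
                    IsSubIso GT GW f → IsSubIso GT GW g
  IsSubIso-resp-≗ g≗f (f-inj , f-edge) =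
      (λ x y gx≡gy → f-inj x y (trans (sym (g≗f x)) (trans gx≡gy (g≗f y))))
    , (λ a b e → subst₂ (E GW) (sym (g≗f a)) (sym (g≗f b)) (f-edge a b e))

  module _ {N : Pred nT} {m : PartialMap N nW} {f : Fin nT → Fin nW}
           (f-iso : IsSubIso GT GW f) (f-ext : Extends m f) where

    image-joinable : ∀ x → Joinable GT GW N m x (f x)
    image-joinable x vi p =
        (λ e → subst (λ z → E GW z (f x)) (f-ext vi p) (proj₂ f-iso vi x e))
      , (λ e → subst (E GW (f x)) (f-ext vi p) (proj₂ f-iso x vi e))

    outside-image-outside-cover : ∀ x → ¬ InImage m (f x) → ¬ N x
    outside-image-outside-cover x fx∉m p = fx∉m (x , p , sym (f-ext x p))

module Transposition {nT nW : ℕ} (GT : Graph nT) (GW : Graph nW) (N : Pred nT)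
    (m : PartialMap N nW) (C : Fin nT → Pred nW)
    (cover : IsNodeCover GT N)
    (candidates : ∀ u → ¬ N u → ∀ c → (C u c ⇔ Joinable GT GW N m u c))
    (w1 w2 : Fin nW) (w1∉m : ¬ InImage m w1) (w2∉m : ¬ InImage m w2)
    (w1∼w2 : NCEquiv N C w1 w2) where

  τ : Fin nW → Fin nW
  τ = transpose w1 w2

  joinable-transfer : ∀ u → ¬ N u → Joinable GT GW N m u w1 ⇔ Joinable GT GW N m u w2
  joinable-transfer u u∉N = ⇔-trans (⇔-sym (candidates u u∉N w1))
                              (⇔-trans (w1∼w2 u u∉N) (candidates u u∉N w2))

  module _ {f : Fin nT → Fin nW} (f-iso : IsSubIso GT GW f) (f-ext : Extends m f) where

    cover-fixed : ∀ x (p : N x) → τ (f x) ≡ m x p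
    cover-fixed x p = trans (cong τ (f-ext x p))
      (transpose-fixes w1 w2 (λ e → w1∉m (x , p , e)) (λ e → w2∉m (x , p , e)))

    transposed-joinable : ∀ x → Joinable GT GW N m x (τ (f x))
    transposed-joinable x = transpose-preserves (Joinable GT GW N m x)
      (λ fx≡w1 → Equivalence.to (joinable-transfer x (x∉N fx≡w1 w1∉m)) (joinable-at fx≡w1))
      (λ fx≡w2 → Equivalence.from (joinable-transfer x (x∉N fx≡w2 w2∉m)) (joinable-at fx≡w2))
      (image-joinable GT GW f-iso f-ext x)
      where
      joinable-at : ∀ {w} → f x ≡ w → Joinable GT GW N m x w
      joinable-at fx≡w = subst (Joinable GT GW N m x) fx≡w (image-joinable GT GW f-iso f-ext x)
      x∉N : ∀ {w} → f x ≡ w → ¬ InImage m w → ¬ N x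
      x∉N fx≡w w∉m = outside-image-outside-cover GT GW f-iso f-ext x
                       (subst (¬_ ∘ InImage m) (sym fx≡w) w∉m)

    transpose-∘-IsSubIso : IsSubIso GT GW (τ ∘ f)
    transpose-∘-IsSubIso = (λ x y e → proj₁ f-iso x y (transpose-injective w1 w2 e)) , edge
      where
      edge : ∀ a b → E GT a b → E GW (τ (f a)) (τ (f b))
      edge a b e with cover a b e
      ... | inj₁ a∈N = subst (λ z → E GW z (τ (f b))) (sym (cover-fixed a a∈N))
                         (proj₁ (transposed-joinable b a a∈N) e)
      ... | inj₂ b∈N = subst (E GW (τ (f a))) (sym (cover-fixed b b∈N))
                         (proj₂ (transposed-joinable a b b∈N) e)

proposition8 : ∀ {nT nW} (GT : Graph nT) (GW : Graph nW) (N : Pred nT) (m : PartialMap N nW)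
                 (C : Fin nT → Pred nW) →
               IsNodeCover GT N →
               IsPartialMatch GT GW N m →
               (∀ u → ¬ N u → ∀ c → (C u c ⇔ Joinable GT GW N m u c)) →
               (w1 w2 : Fin nW) →
               ¬ InImage m w1 → ¬ InImage m w2 →
               NCEquiv N C w1 w2 →
               Interchangeable GT GW N m w1 w2
proposition8 GT GW N m C cover _ candidates w1 w2 w1∉m w2∉m w1∼w2 f f-iso f-ext =
    (λ v w fv≡w1 fw≡w2 → IsSubIso-resp-≗ GT GW
       (update²-≗-transpose f-inj fv≡w1 fw≡w2) (T₁₂.transpose-∘-IsSubIso f-iso f-ext))
  , (λ v fv≡w1 w2∉f → IsSubIso-resp-≗ GT GW
       (update-≗-transpose f-inj fv≡w1 w2∉f) (T₁₂.transpose-∘-IsSubIso f-iso f-ext))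
  , (λ v fv≡w2 w1∉f → IsSubIso-resp-≗ GT GW
       (update-≗-transpose f-inj fv≡w2 w1∉f) (T₂₁.transpose-∘-IsSubIso f-iso f-ext))
  where
  module T₁₂ = Transposition GT GW N m C cover candidates w1 w2 w1∉m w2∉m w1∼w2
  module T₂₁ = Transposition GT GW N m C cover candidates w2 w1 w2∉m w1∉m
                 (λ u u∉N → ⇔-sym (w1∼w2 u u∉N))
  f-inj : Injective _≡_ _≡_ f
  f-inj = proj₁ f-iso _ _
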